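{- Every 2-ball multiplex prime juggling pattern that is not a normal 2-ball prime pattern (i.e. some state of the cycle has an entry equal to $2$) contains the state $\langle 2\rangle=(2,0,0,\dots)$ exactly once.
   Context: A 2-ball multiplex state (hand capacity $2$) is a sequence $\alpha=(\alpha_1,\alpha_2,\dots)$ with $\alpha_i\in\{0,1,2\}$, finitely many nonzero, and $\sum_i\alpha_i=2$; $\alpha_i$ is the number of balls landing $i$ beats from now. There is a directed edge (transition) $\alpha\to\beta$ between two such states iff $\alpha_{i+1}\le\beta_i$ for all $i\ge1$. A 2-ball multiplex prime juggling pattern of period $n$ is a directed cycle of length $n$ in this graph, i.e. a closed walk $\sigma_0\to\sigma_1\to\cdots\to\sigma_{n-1}\to\sigma_0$ with $\sigma_0,\dots,\sigma_{n-1}$ distinct, considered up to cyclic rotation. It is a normal pattern if all of its states have entries in $\{0,1\}$. -}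

module Defs where

open import Data.Nat using (ℕ; zero; suc; _+_; _≤_; _<_; _≥_)
open import Data.Fin using (Fin; toℕ; fromℕ<)
open import Data.Nat.DivMod using (_%_; m%n<n)
open import Data.Product using (Σ; ∃; _×_; _,_)
open import Relation.Binary.PropositionalEquality using (_≡_)
open import Relation.Nullary using (¬_)

-- A state is encoded as a function s : ℕ → ℕ with  s i = α_(i+1)
-- (index 0 is the number of balls landing 1 beat from now).

sumTo : (ℕ → ℕ) → ℕ → ℕ
sumTo s zero    = 0
sumTo s (suc N) = sumTo s N + s N

record IsState (s : ℕ → ℕ) : Set where
  field
    entry≤2 : ∀ i → s i ≤ 2
    support : ℕ
    zeroBeyond : ∀ i → support ≤ i → s i ≡ 0
    total : sumTo s support ≡ 2

_≈ₛ_ : (ℕ → ℕ) → (ℕ → ℕ) → Set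
s ≈ₛ t = ∀ i → s i ≡ t i

Edge : (ℕ → ℕ) → (ℕ → ℕ) → Set
Edge a b = ∀ i → a (suc i) ≤ b i

two : ℕ → ℕ
two zero    = 2
two (suc _) = 0

next : ∀ {n} → Fin n → Fin n
next {zero} ()
next {suc n} k = fromℕ< (m%n<n (suc (toℕ k)) (suc n))

-- a 2-ball multiplex prime juggling pattern of period n:
-- a directed cycle σ_0 → ... → σ_(n-1) → σ_0 with distinct states
record Pattern (n : ℕ) : Set where
  field
    σ : Fin n → ℕ → ℕ
    isState : ∀ k → IsState (σ k)
    edge : ∀ k → Edge (σ k) (σ (next k))
    distinct : ∀ j k → σ j ≈ₛ σ k → j ≡ k

IsNormal : ∀ {n} → Pattern n → Set
IsNormal {n} P = ∀ k i → Pattern.σ P k i ≤ 1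

HasTwo : ∀ {n} → Pattern n → Set
HasTwo {n} P = ∃ λ k → ∃ λ i → Pattern.σ P k i ≡ 2

{-# OPTIONS --safe #-}
module Submission where

-- A 2 at position i + 1 of a state must move to position i of the next state, because an edge
-- only lets entries grow and no entry exceeds 2. Following the cycle for i steps therefore
-- reaches a state with 2 balls landing on the next beat; as a state holds only 2 balls, it is ⟨2⟩.
-- Uniqueness is the distinctness of the states of a prime pattern.

open import Defs
open import Data.Nat using (ℕ; zero; suc; _+_; _≤_; _<_; _≤′_; ≤′-refl; ≤′-step; s≤s; z≤n; _<?_)
open import Data.Nat.Properties
open import Data.Product using (∃; _×_; _,_)
open import Relation.Binary.PropositionalEquality using (_≡_; sym; trans; subst; cong)
open import Relation.Nullary using (yes; no)

sumTo-mono : ∀ s {m n} → m ≤ n → sumTo s m ≤ sumTo s n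
sumTo-mono s m≤n = mono′ (≤⇒≤′ m≤n)
  where
  mono′ : ∀ {m n} → m ≤′ n → sumTo s m ≤ sumTo s n
  mono′ ≤′-refl        = ≤-refl
  mono′ (≤′-step m≤′n) = ≤-trans (mono′ m≤′n) (m≤m+n _ _)

entry+entry≤sumTo : ∀ s {i j N} → i < j → j < N → s i + s j ≤ sumTo s N
entry+entry≤sumTo s {i} {j} {N} i<j j<N = begin
  s i + s j                  ≤⟨ +-monoˡ-≤ (s j) (m≤n+m (s i) (sumTo s i)) ⟩
  sumTo s (suc i) + s j      ≤⟨ +-monoˡ-≤ (s j) (sumTo-mono s i<j) ⟩
  sumTo s (suc j)            ≤⟨ sumTo-mono s j<N ⟩
  sumTo s N                  ∎
  where open ≤-Reasoning

front≡2⇒≈two : ∀ {s} → IsState s → s 0 ≡ 2 → s ≈ₛ two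
front≡2⇒≈two     st s0≡2 zero = s0≡2
front≡2⇒≈two {s} st s0≡2 (suc j) with suc j <? IsState.support st
... | no  1+j≮support = IsState.zeroBeyond st (suc j) (≮⇒≥ 1+j≮support)
... | yes 1+j<support = n≤0⇒n≡0 (+-cancelˡ-≤ 2 (s (suc j)) 0 2+sj≤2)
  where
  2+sj≤2 : 2 + s (suc j) ≤ 2
  2+sj≤2 = begin
    2 + s (suc j)                    ≡⟨ cong (_+ s (suc j)) (sym s0≡2) ⟩
    s 0 + s (suc j)                  ≤⟨ entry+entry≤sumTo s (s≤s z≤n) 1+j<support ⟩
    sumTo s (IsState.support st)     ≡⟨ IsState.total st ⟩
    2                                ∎
    where open ≤-Reasoning

Edge-shifts-2 : ∀ {a b} → Edge a b → (∀ i → b i ≤ 2) → ∀ i → a (suc i) ≡ 2 → b i ≡ 2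
Edge-shifts-2 a→b b≤2 i a≡2 = ≤-antisym (b≤2 i) (subst (_≤ _) a≡2 (a→b i))

module _ {n} (P : Pattern n) where
  open Pattern P

  reach-front-2 : ∀ i k → σ k i ≡ 2 → ∃ λ k′ → σ k′ 0 ≡ 2
  reach-front-2 zero    k σki≡2 = k , σki≡2
  reach-front-2 (suc i) k σki≡2 =
    reach-front-2 i (next k)
      (Edge-shifts-2 {σ k} (edge k) (IsState.entry≤2 (isState (next k))) i σki≡2)

lemma3p2 : (n : ℕ) (P : Pattern n) → HasTwo P →
    ∃ λ k → (Pattern.σ P k ≈ₛ two)
      × (∀ j → Pattern.σ P j ≈ₛ two → j ≡ k)
lemma3p2 _ P (k , i , σki≡2) with reach-front-2 P i k σki≡2
... | k′ , σk′0≡2 =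
  k′ , σk′≈two , λ j σj≈two → distinct j k′ (λ x → trans (σj≈two x) (sym (σk′≈two x)))
  where
  open Pattern P
  σk′≈two : σ k′ ≈ₛ two
  σk′≈two = front≡2⇒≈two (isState k′) σk′0≡2
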